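{- Let $k\in\mathbb{N}_0$ and let $(F_i)_{i\in I}$ be an acyclic finite family of clause-sets. If $F_i\in\mathcal{PC}_k$ for all $i\in I$, then $\bigcup_{i\in I}F_i\in\mathcal{PC}_k$.
   Context: Literals, clauses (finite sets of literals without complementary pairs), clause-sets (finite sets of clauses); $\bot$ empty clause; $\mathrm{var}$. Partial assignments $\varphi$ and $\varphi*F$ (delete clauses containing a true literal, delete false literals). A literal $x$ is forced for $F$ if $\langle x\to0\rangle*F$ is unsatisfiable. Generalised unit propagation: $r_0(F)=\{\bot\}$ if $\bot\in F$ and $F$ otherwise; $r_{k+1}(F)=\{\bot\}$ if $r_k(F)=\{\bot\}$, else if some literal $x$ has $r_k(\langle x\to0\rangle*F)=\{\bot\}$ then $r_{k+1}(F)=r_{k+1}(\langle x\to1\rangle*F)$, else $r_{k+1}(F)=F$. $r_\infty(F)$ is $\{\bot\}$ if $F$ is unsatisfiable and otherwise the result of applying all forced assignments. $\mathcal{PC}_k$ is the class of clause-sets $F$ such that $r_k(\varphi*F)=r_\infty(\varphi*F)$ for all partial assignments $\varphi$. Incidence graph of $(F_i)_{i\in I}$: bipartite graph with parts $\bigcup_{i}\mathrm{var}(F_i)$ and $I$, $v$ adjacent to $i$ iff $v\in\mathrm{var}(F_i)$; the family is acyclic if this graph has no cycle. -}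

module Defs where

open import Data.Nat using (ℕ; zero; suc)
open import Data.Fin using (Fin; zero; suc; inject₁; fromℕ)
open import Data.Bool using (Bool; true; false; not; _∨_; if_then_else_)
open import Data.Maybe using (Maybe; just; nothing)
open import Data.Vec using (Vec; []; _∷_; lookup; replicate; _[_]≔_)
open import Data.List using (List; []; _∷_; [_]; concatMap)
open import Data.List.Membership.Propositional using (_∈_; _∉_)
open import Data.Fin.Base using () renaming (toℕ to toℕ)
open import Data.List using (allFin)
open import Data.Product using (Σ; _×_; _,_; ∃)
open import Data.Sum using (_⊎_)
open import Relation.Nullary using (¬_)
open import Relation.Binary.PropositionalEquality using (_≡_)
open import Function.Bundles using (_⇔_)
open import Function.Definitions using (Injective)

-- Variables are the elements of Fin n (n is an arbitrary, fixed finite universe).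
-- A literal is a pair (v , b): b = true is the positive literal v, b = false is ¬v.
Lit : ℕ → Set
Lit n = Fin n × Bool

-- A clause (finite set of literals without complementary pairs) is represented
-- canonically: for each variable v, either v does not occur (nothing), or
-- exactly one of its literals occurs (just b = the literal (v , b)).
Clause : ℕ → Set
Clause n = Vec (Maybe Bool) n

_∈C_ : ∀ {n} → Lit n → Clause n → Set
(v , b) ∈C C = lookup C v ≡ just b

-- A clause-set (finite set of clauses) is a list of clauses, read as the set
-- of its members; equality of clause-sets is equality as sets.
ClauseSet : ℕ → Set
ClauseSet n = List (Clause n)

_≈_ : ∀ {n} → ClauseSet n → ClauseSet n → Set
F ≈ G = ∀ C → (C ∈ F) ⇔ (C ∈ G)

⊥C : ∀ {n} → Clause n
⊥C {n} = replicate n nothing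

Bot : ∀ {n} → ClauseSet n
Bot = [ ⊥C ]

_occursIn_ : ∀ {n} → Fin n → ClauseSet n → Set
v occursIn F = Σ _ λ C → C ∈ F × ∃ λ b → lookup C v ≡ just b

-- Partial assignments: v ↦ nothing (unassigned) or just ε (value ε).
PAss : ℕ → Set
PAss n = Vec (Maybe Bool) n

agree : Maybe Bool → Maybe Bool → Bool
agree (just true) (just true) = true
agree (just false) (just false) = true
agree _ _ = false

satC : ∀ {n} → PAss n → Clause n → Bool
satC [] [] = false
satC (a ∷ φ) (c ∷ C) = agree a c ∨ satC φ C

reduce : ∀ {n} → PAss n → Clause n → Clause n
reduce [] [] = []
reduce (just _ ∷ φ) (_ ∷ C) = nothing ∷ reduce φ C
reduce (nothing ∷ φ) (c ∷ C) = c ∷ reduce φ C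

_*_ : ∀ {n} → PAss n → ClauseSet n → ClauseSet n
φ * [] = []
φ * (C ∷ F) = if satC φ C then φ * F else (reduce φ C ∷ φ * F)

⟨_↦_⟩ : ∀ {n} → Lit n → Bool → PAss n
⟨_↦_⟩ {n} (v , b) ε = replicate n nothing [ v ]≔ just (if ε then b else not b)

total : ∀ {n} → Vec Bool n → PAss n
total [] = []
total (b ∷ t) = just b ∷ total t

Satisfiable : ∀ {n} → ClauseSet n → Set
Satisfiable {n} F = Σ (Vec Bool n) λ t → ∀ C → C ∈ F → satC (total t) C ≡ true

Unsatisfiable : ∀ {n} → ClauseSet n → Set
Unsatisfiable F = ¬ Satisfiable F

Forced : ∀ {n} → Lit n → ClauseSet n → Set
Forced x F = Unsatisfiable (⟨ x ↦ false ⟩ * F)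

-- Generalised unit propagation r_k, as a relation  R k F G  ("G = r_k(F)").
-- The choice of the literal x in the definition is nondeterministic; R k F G
-- holds for every possible outcome.

IsBotBy : ∀ {n} → (ClauseSet n → ClauseSet n → Set) → ClauseSet n → Set
IsBotBy Rk F = Σ _ λ G → Rk F G × G ≈ Bot

data Step {n} (Rk : ClauseSet n → ClauseSet n → Set) :
          ClauseSet n → ClauseSet n → Set where
  bot  : ∀ {F} → IsBotBy Rk F → Step Rk F Bot
  prop : ∀ {F G} → ¬ IsBotBy Rk F → (x : Lit n) →
         IsBotBy Rk (⟨ x ↦ false ⟩ * F) →
         Step Rk (⟨ x ↦ true ⟩ * F) G → Step Rk F G
  stay : ∀ {F} → ¬ IsBotBy Rk F →
         (∀ (x : Lit n) → ¬ IsBotBy Rk (⟨ x ↦ false ⟩ * F)) → Step Rk F F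

R : ∀ {n} → ℕ → ClauseSet n → ClauseSet n → Set
R zero F G = (⊥C ∈ F × G ≡ Bot) ⊎ (⊥C ∉ F × G ≡ F)
R (suc k) = Step (R k)

IsForcedAss : ∀ {n} → ClauseSet n → PAss n → Set
IsForcedAss F φ = ∀ v b → (lookup φ v ≡ just b) ⇔ Forced (v , b) F

Rinf : ∀ {n} → ClauseSet n → ClauseSet n → Set
Rinf F G = (Unsatisfiable F × G ≈ Bot)
         ⊎ (Satisfiable F × Σ _ λ φ → IsForcedAss F φ × G ≈ (φ * F))

PC : ∀ {n} → ℕ → ClauseSet n → Set
PC {n} k F = ∀ (φ : PAss n) G → R k (φ * F) G → Rinf (φ * F) G

⋃ : ∀ {n m} → (Fin m → ClauseSet n) → ClauseSet n
⋃ {m = m} F = concatMap F (allFin m)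

-- A cycle in the incidence graph: v₀ i₀ v₁ i₁ … v_l i_l v₀ with l ≥ 1,
-- pairwise distinct variables, pairwise distinct indices,
-- v_j, v_{j+1} ∈ var(F_{i_j}) and v₀ ∈ var(F_{i_l}).
record Cycle {n m} (F : Fin m → ClauseSet n) : Set where
  field
    l      : ℕ
    vs     : Fin (suc (suc l)) → Fin n
    is     : Fin (suc (suc l)) → Fin m
    vs-inj : Injective _≡_ _≡_ vs
    is-inj : Injective _≡_ _≡_ is
    here   : ∀ j → vs j occursIn F (is j)
    next   : ∀ (j : Fin (suc l)) → vs (suc j) occursIn F (is (inject₁ j))
    close  : vs zero occursIn F (is (fromℕ (suc l)))

Acyclic : ∀ {n m} → (Fin m → ClauseSet n) → Set
Acyclic F = ¬ Cycle F

module Submission where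

-- Run r_k on the union.  Every assignment of a forced literal it makes can be made on all members
-- at once, which keeps them in PC_k and keeps the family acyclic.  When r_k stops on the union it
-- stops on each member too (refutation by r_k is monotone), so by PC_k no member has a forced
-- literal: each is satisfiable with every occurring variable free to take either value.  Such
-- models glue along an acyclic family, since some member shares at most one variable with the
-- others; hence the union has no forced literal either and equals its own r_∞.

open import Defs
open import Algebra.Bundles using (CommutativeMonoid)
open import Data.Bool using (Bool; true; false; not; _∨_; if_then_else_)
import Data.Bool.Properties as Boolₚ
open import Data.Empty using (⊥; ⊥-elim)
open import Data.Fin as Fin using (Fin; zero; suc; toℕ; fromℕ; punchIn; punchOut)
import Data.Fin.Properties as Finₚ
open import Data.List using ([]; _∷_; allFin)
open import Data.List.Membership.Propositional using (_∈_; _∉_; find; lose)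
open import Data.List.Membership.Propositional.Properties using (∈-concatMap⁺; ∈-concatMap⁻; ∈-allFin)
open import Data.List.Relation.Binary.Subset.Propositional using (_⊆_)
import Data.List.Relation.Unary.All as All
open import Data.List.Relation.Unary.Any using (here; there)
import Data.List.Relation.Unary.Any as Any
open import Data.Maybe using (Maybe; just; nothing; fromMaybe; _<∣>_)
import Data.Maybe.Properties as Maybeₚ
open import Data.Nat using (ℕ; zero; suc; _+_; _≤_; _<_; z≤n; s≤s)
open import Data.Nat.Induction using (<-wellFounded)
import Data.Nat.Properties as ℕₚ
open import Data.Product using (_×_; _,_; ∃; ∃₂; proj₁; proj₂)
open import Data.Sum using (_⊎_; inj₁; inj₂)
open import Data.Vec using (Vec; []; _∷_; lookup; replicate; tabulate; zipWith; _[_]≔_)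
import Data.Vec.Properties as Vecₚ
open import Function using (_∘_; id)
open import Function.Bundles using (_⇔_; mk⇔; Equivalence)
open import Function.Definitions using (Injective)
open import Function.Properties.Equivalence using () renaming (trans to ⇔-trans)
open import Induction.WellFounded using (Acc; acc)
open import Relation.Binary.PropositionalEquality
open import Relation.Nullary using (¬_; Dec; yes; no; does)
open import Relation.Nullary.Decidable using (decidable-stable; map′; _×-dec_; _⊎-dec_; ¬?)

open import Algebra.Properties.CommutativeSemigroup
  (CommutativeMonoid.commutativeSemigroup Boolₚ.∨-commutativeMonoid) using (x∙yz≈y∙xz)

private variable
  n m : ℕ

agree⇒just : ∀ a c → agree a c ≡ true → ∃ λ b → a ≡ just b × c ≡ just b
agree⇒just (just true)  (just true)  _ = true , refl , refl
agree⇒just (just false) (just false) _ = false , refl , refl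
agree⇒just (just true)  (just false) ()
agree⇒just (just true)  nothing      ()
agree⇒just (just false) (just true)  ()
agree⇒just (just false) nothing      ()
agree⇒just nothing      _            ()

agree-just : ∀ b → agree (just b) (just b) ≡ true
agree-just true  = refl
agree-just false = refl

agree-nothingʳ : ∀ a → agree a nothing ≡ false
agree-nothingʳ (just true)  = refl
agree-nothingʳ (just false) = refl
agree-nothingʳ nothing      = refl

satC⇒agree : ∀ (φ : PAss n) C → satC φ C ≡ true →
             ∃ λ u → agree (lookup φ u) (lookup C u) ≡ true
satC⇒agree []      []      ()
satC⇒agree (a ∷ φ) (c ∷ C) sat with agree a c in eq
... | true  = zero , eq
... | false = let u , p = satC⇒agree φ C sat in suc u , p

agree⇒satC : ∀ (φ : PAss n) C u → agree (lookup φ u) (lookup C u) ≡ true → satC φ C ≡ true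
agree⇒satC (a ∷ φ) (c ∷ C) zero    e rewrite e = refl
agree⇒satC (a ∷ φ) (c ∷ C) (suc u) e rewrite agree⇒satC φ C u e = Boolₚ.∨-zeroʳ (agree a c)

lookup-reduce-assigned : ∀ (φ : PAss n) C u {d} → lookup φ u ≡ just d →
                         lookup (reduce φ C) u ≡ nothing
lookup-reduce-assigned (just _  ∷ φ) (c ∷ C) zero    e = refl
lookup-reduce-assigned (just _  ∷ φ) (c ∷ C) (suc u) e = lookup-reduce-assigned φ C u e
lookup-reduce-assigned (nothing ∷ φ) (c ∷ C) (suc u) e = lookup-reduce-assigned φ C u e

lookup-reduce-unassigned : ∀ (φ : PAss n) C u → lookup φ u ≡ nothing →
                           lookup (reduce φ C) u ≡ lookup C u
lookup-reduce-unassigned (nothing ∷ φ) (c ∷ C) zero    e = refl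
lookup-reduce-unassigned (just _  ∷ φ) (c ∷ C) (suc u) e = lookup-reduce-unassigned φ C u e
lookup-reduce-unassigned (nothing ∷ φ) (c ∷ C) (suc u) e = lookup-reduce-unassigned φ C u e

∈-*⁻ : ∀ (φ : PAss n) F {C} → C ∈ φ * F →
       ∃ λ C′ → C′ ∈ F × satC φ C′ ≡ false × C ≡ reduce φ C′
∈-*⁻ φ (D ∷ F) C∈ with satC φ D in eq | C∈
... | true  | C∈′         = let C′ , C′∈ , r = ∈-*⁻ φ F C∈′ in C′ , there C′∈ , r
... | false | here refl   = D , here refl , eq , refl
... | false | there C∈′   = let C′ , C′∈ , r = ∈-*⁻ φ F C∈′ in C′ , there C′∈ , r

∈-*⁺ : ∀ (φ : PAss n) F {C} → C ∈ F → satC φ C ≡ false → reduce φ C ∈ φ * F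
∈-*⁺ φ (D ∷ F) (here refl) unsat rewrite unsat = here refl
∈-*⁺ φ (D ∷ F) (there C∈)  unsat with satC φ D
... | true  = ∈-*⁺ φ F C∈ unsat
... | false = there (∈-*⁺ φ F C∈ unsat)

*-mono : ∀ (φ : PAss n) {F G} → F ⊆ G → φ * F ⊆ φ * G
*-mono φ {F} {G} F⊆G C∈ with ∈-*⁻ φ F C∈
... | C′ , C′∈ , unsat , refl = ∈-*⁺ φ G (F⊆G C′∈) unsat

occursIn-* : ∀ (φ : PAss n) F v → v occursIn (φ * F) → v occursIn F
occursIn-* φ F v (C , C∈ , b , e) with ∈-*⁻ φ F C∈
... | C′ , C′∈ , _ , refl with lookup φ v in φv
... | nothing = C′ , C′∈ , b , trans (sym (lookup-reduce-unassigned φ C′ v φv)) e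
... | just _  with trans (sym (lookup-reduce-assigned φ C′ v φv)) e
...   | ()

occursIn? : ∀ (v : Fin n) F → Dec (v occursIn F)
occursIn? v F = map′ find (λ (C , C∈ , occ) → lose C∈ occ) (Any.any? (λ C → isJust? (lookup C v)) F)
  where
  isJust? : ∀ (a : Maybe Bool) → Dec (∃ λ b → a ≡ just b)
  isJust? (just b) = yes (b , refl)
  isJust? nothing  = no λ ()

Models : Vec Bool n → ClauseSet n → Set
Models t F = ∀ C → C ∈ F → satC (total t) C ≡ true

Extends : PAss n → Vec Bool n → Set
Extends φ t = ∀ u b → lookup φ u ≡ just b → lookup t u ≡ b

lookup-total : (t : Vec Bool n) (u : Fin n) → lookup (total t) u ≡ just (lookup t u)
lookup-total (b ∷ t) zero    = refl
lookup-total (b ∷ t) (suc u) = lookup-total t u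

satC-total⁻ : ∀ (t : Vec Bool n) C → satC (total t) C ≡ true →
              ∃ λ u → lookup C u ≡ just (lookup t u)
satC-total⁻ t C sat with satC⇒agree (total t) C sat
... | u , agr with agree⇒just _ _ agr
...   | b , tu , Cu = u , trans Cu (sym (trans (sym (lookup-total t u)) tu))

satC-total⁺ : ∀ (t : Vec Bool n) C u → lookup C u ≡ just (lookup t u) → satC (total t) C ≡ true
satC-total⁺ t C u Cu = agree⇒satC (total t) C u
  (subst₂ (λ a c → agree a c ≡ true) (sym (lookup-total t u)) (sym Cu) (agree-just (lookup t u)))

Models-* : ∀ (φ : PAss n) F t → Models t F → Extends φ t → Models t (φ * F)
Models-* φ F t t⊨F t⊇φ C C∈ with ∈-*⁻ φ F C∈
... | C′ , C′∈ , unsat , refl with satC-total⁻ t C′ (t⊨F C′ C′∈)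
...   | u , C′u with lookup φ u in φu
...     | nothing = satC-total⁺ t (reduce φ C′) u (trans (lookup-reduce-unassigned φ C′ u φu) C′u)
...     | just b  = ⊥-elim (Boolₚ.not-¬ sat unsat)
  where
  sat : satC φ C′ ≡ true
  sat = agree⇒satC φ C′ u (subst₂ (λ a c → agree a c ≡ true)
          (sym φu) (sym (trans C′u (cong just (t⊇φ u b φu)))) (agree-just b))

override : PAss n → Vec Bool n → Vec Bool n
override φ t = tabulate λ u → fromMaybe (lookup t u) (lookup φ u)

lookup-override : ∀ (φ : PAss n) t u → lookup (override φ t) u ≡ fromMaybe (lookup t u) (lookup φ u)
lookup-override φ t = Vecₚ.lookup∘tabulate _

override-extends : ∀ (φ : PAss n) t → Extends φ (override φ t)
override-extends φ t u b φu = trans (lookup-override φ t u) (cong (fromMaybe _) φu)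

lookup-override-unassigned : ∀ (φ : PAss n) t u → lookup φ u ≡ nothing → lookup (override φ t) u ≡ lookup t u
lookup-override-unassigned φ t u φu = trans (lookup-override φ t u) (cong (fromMaybe _) φu)

Models-override : ∀ (φ : PAss n) F t → Models t (φ * F) → Models (override φ t) F
Models-override φ F t t⊨φF C C∈ with satC φ C in eq
... | true with satC⇒agree φ C eq
...   | u , agr with agree⇒just _ _ agr
...     | b , φu , Cu = satC-total⁺ (override φ t) C u (trans Cu (cong just (sym (override-extends φ t u b φu))))
Models-override φ F t t⊨φF C C∈ | false with satC-total⁻ t (reduce φ C) (t⊨φF _ (∈-*⁺ φ F C∈ eq))
... | u , Cu with lookup φ u in φu
...   | nothing = satC-total⁺ (override φ t) C u
                  (trans (sym (lookup-reduce-unassigned φ C u φu))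
                         (trans Cu (cong just (sym (lookup-override-unassigned φ t u φu)))))
...   | just _ with trans (sym (lookup-reduce-assigned φ C u φu)) Cu
...     | ()

satisfiable-*⇔ : ∀ (φ : PAss n) F → Satisfiable (φ * F) ⇔ (∃ λ t → Models t F × Extends φ t)
satisfiable-*⇔ φ F = mk⇔ (λ (t , t⊨) → override φ t , Models-override φ F t t⊨ , override-extends φ t)
                          (λ (t , t⊨ , t⊇φ) → t , Models-* φ F t t⊨ t⊇φ)

Models-cong : ∀ (t t′ : Vec Bool n) F → Models t F →
              (∀ u → u occursIn F → lookup t u ≡ lookup t′ u) → Models t′ F
Models-cong t t′ F t⊨F t≈t′ C C∈ with satC-total⁻ t C (t⊨F C C∈)
... | u , Cu = satC-total⁺ t′ C u (trans Cu (cong just (t≈t′ u (C , C∈ , _ , Cu))))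

-- ⟨ (v , b) ↦ true ⟩ and ⟨ (v , b) ↦ false ⟩ reduce to single v b and single v (not b).
single : Fin n → Bool → PAss n
single {n} v b = replicate n nothing [ v ]≔ just b

lookup-single : ∀ (v : Fin n) b → lookup (single v b) v ≡ just b
lookup-single {n} v b = Vecₚ.lookup∘update v (replicate n nothing) (just b)

lookup-single-other : ∀ {v u : Fin n} b → v ≢ u → lookup (single v b) u ≡ nothing
lookup-single-other {n} {v} {u} b v≢u =
  trans (Vecₚ.lookup∘update′ (v≢u ∘ sym) (replicate n nothing) (just b)) (Vecₚ.lookup-replicate u nothing)

assigned-single : ∀ (v u : Fin n) {d b} → lookup (single v d) u ≡ just b → v ≡ u
assigned-single v u φu with v Fin.≟ u
... | yes v≡u = v≡u
... | no  v≢u with trans (sym (lookup-single-other _ v≢u)) φu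
...   | ()

Extends-single : ∀ {v : Fin n} {b} t → lookup t v ≡ b → Extends (single v b) t
Extends-single {v = v} t tv u c φu with assigned-single v u φu
... | refl = trans tv (Maybeₚ.just-injective (trans (sym (lookup-single v _)) φu))

ModelWith : ClauseSet n → Fin n → Bool → Set
ModelWith {n} F v b = ∃ λ (t : Vec Bool n) → Models t F × lookup t v ≡ b

satisfiable-single⇔ : ∀ (F : ClauseSet n) v b → Satisfiable (single v b * F) ⇔ ModelWith F v b
satisfiable-single⇔ F v b = mk⇔
  (λ sat → let t , t⊨ , t⊇ = Equivalence.to (satisfiable-*⇔ _ F) sat in t , t⊨ , t⊇ v b (lookup-single v b))
  (λ (t , t⊨ , tv) → Equivalence.from (satisfiable-*⇔ _ F) (t , t⊨ , Extends-single t tv))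

forced⇔ : ∀ (F : ClauseSet n) v b → Forced (v , b) F ⇔ (¬ ModelWith F v (not b))
forced⇔ F v b = mk⇔ (λ forced → forced ∘ Equivalence.from (satisfiable-single⇔ F v (not b)))
                    (λ free → free ∘ Equivalence.to (satisfiable-single⇔ F v (not b)))

ModelWith-single⇔ : ∀ (F : ClauseSet n) {v u} b d → v ≢ u →
                    ModelWith (single v b * F) u d ⇔ (∃ λ t → Models t F × lookup t v ≡ b × lookup t u ≡ d)
ModelWith-single⇔ F {v} {u} b d v≢u = mk⇔
  (λ (t , t⊨ , tu) → override (single v b) t , Models-override _ F t t⊨
                   , override-extends (single v b) t v b (lookup-single v b)
                   , trans (lookup-override-unassigned (single v b) t u (lookup-single-other b v≢u)) tu)
  (λ (t , t⊨ , tv , tu) → t , Models-* _ F t t⊨ (Extends-single t tv) , tu)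

unsat-split : ∀ (F : ClauseSet n) v b → Unsatisfiable (single v (not b) * F) →
              Unsatisfiable (single v b * F) → Unsatisfiable F
unsat-split F v b unsat₀ unsat₁ (t , t⊨) with lookup t v Boolₚ.≟ b
... | yes tv = unsat₁ (Equivalence.from (satisfiable-single⇔ F v b) (t , t⊨ , tv))
... | no  tv = unsat₀ (Equivalence.from (satisfiable-single⇔ F v (not b)) (t , t⊨ , Boolₚ.¬-not tv))

∃-Vec? : ∀ n {P : Vec Bool n → Set} → (∀ t → Dec (P t)) → Dec (∃ P)
∃-Vec? zero    P? = map′ ([] ,_) (λ { ([] , p) → p }) (P? [])
∃-Vec? (suc n) P? with ∃-Vec? n (λ t → P? (true ∷ t)) | ∃-Vec? n (λ t → P? (false ∷ t))
... | yes (t , p) | _           = yes (true ∷ t , p)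
... | no _        | yes (t , p) = yes (false ∷ t , p)
... | no ¬p₁      | no ¬p₀      = no λ { (true ∷ t , p) → ¬p₁ (t , p) ; (false ∷ t , p) → ¬p₀ (t , p) }

Models? : ∀ (t : Vec Bool n) F → Dec (Models t F)
Models? t F = map′ (λ all C C∈ → All.lookup all C∈) (λ t⊨ → All.tabulate (t⊨ _))
                   (All.all? (λ C → satC (total t) C Boolₚ.≟ true) F)

ModelWith? : ∀ (F : ClauseSet n) v b → Dec (ModelWith F v b)
ModelWith? {n} F v b = ∃-Vec? n λ t → Models? t F ×-dec (lookup t v Boolₚ.≟ b)

lookup-ext : ∀ {A : Set} {xs ys : Vec A n} → (∀ u → lookup xs u ≡ lookup ys u) → xs ≡ ys
lookup-ext {xs = xs} {ys} eq =
  trans (sym (Vecₚ.tabulate∘lookup xs)) (trans (Vecₚ.tabulate-cong eq) (Vecₚ.tabulate∘lookup ys))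

satC-single-nonoccurring : ∀ {v : Fin n} d C → lookup C v ≡ nothing → satC (single v d) C ≡ false
satC-single-nonoccurring {v = v} d C Cv with satC (single v d) C in sat
... | false = refl
... | true with satC⇒agree (single v d) C sat
...   | u , agr with agree⇒just _ _ agr
...     | _ , φu , Cu with assigned-single v u φu
...       | refl with trans (sym Cv) Cu
...         | ()

reduce-single-nonoccurring : ∀ {v : Fin n} d C → lookup C v ≡ nothing → reduce (single v d) C ≡ C
reduce-single-nonoccurring {v = v} d C Cv = lookup-ext λ u → lookup-reduce u (v Fin.≟ u)
  where
  lookup-reduce : ∀ u → Dec (v ≡ u) → lookup (reduce (single v d) C) u ≡ lookup C u
  lookup-reduce u (yes refl) = trans (lookup-reduce-assigned (single v d) C v (lookup-single v d)) (sym Cv)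
  lookup-reduce u (no v≢u)   = lookup-reduce-unassigned (single v d) C u (lookup-single-other d v≢u)

single-*-nonoccurring : ∀ {v : Fin n} d F → ¬ v occursIn F → single v d * F ≡ F
single-*-nonoccurring         d []      _ = refl
single-*-nonoccurring {v = v} d (C ∷ F) v∉ with lookup C v in Cv
... | just b  = ⊥-elim (v∉ (C , here refl , b , Cv))
... | nothing rewrite satC-single-nonoccurring d C Cv =
  cong₂ _∷_ (reduce-single-nonoccurring d C Cv)
            (single-*-nonoccurring d F λ (D , D∈ , occ) → v∉ (D , there D∈ , occ))

_⊕_ : PAss n → PAss n → PAss n
φ ⊕ ψ = zipWith _<∣>_ φ ψ

lookup-⊕ : ∀ (φ ψ : PAss n) u → lookup (φ ⊕ ψ) u ≡ (lookup φ u <∣> lookup ψ u)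
lookup-⊕ φ ψ u = Vecₚ.lookup-zipWith _<∣>_ u φ ψ

∅ : PAss n
∅ {n} = replicate n nothing

satC-⊕ : ∀ (φ ψ : PAss n) C → satC (φ ⊕ ψ) C ≡ satC φ C ∨ satC ψ (reduce φ C)
satC-⊕ []           []      []      = refl
satC-⊕ (just x ∷ φ) (b ∷ ψ) (c ∷ C) rewrite satC-⊕ φ ψ C | agree-nothingʳ b =
  sym (Boolₚ.∨-assoc (agree (just x) c) (satC φ C) _)
satC-⊕ (nothing ∷ φ) (b ∷ ψ) (c ∷ C) rewrite satC-⊕ φ ψ C = x∙yz≈y∙xz (agree b c) (satC φ C) _

reduce-⊕ : ∀ (φ ψ : PAss n) C → reduce ψ (reduce φ C) ≡ reduce (φ ⊕ ψ) C
reduce-⊕ []            []           []      = refl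
reduce-⊕ (just _ ∷ φ)  (just _ ∷ ψ)  (c ∷ C) = cong (nothing ∷_) (reduce-⊕ φ ψ C)
reduce-⊕ (just _ ∷ φ)  (nothing ∷ ψ) (c ∷ C) = cong (nothing ∷_) (reduce-⊕ φ ψ C)
reduce-⊕ (nothing ∷ φ) (just _ ∷ ψ)  (c ∷ C) = cong (nothing ∷_) (reduce-⊕ φ ψ C)
reduce-⊕ (nothing ∷ φ) (nothing ∷ ψ) (c ∷ C) = cong (c ∷_) (reduce-⊕ φ ψ C)

*-⊕ : ∀ (φ ψ : PAss n) F → ψ * (φ * F) ≡ (φ ⊕ ψ) * F
*-⊕ φ ψ []      = refl
*-⊕ φ ψ (C ∷ F) with satC φ C in φC | satC ψ (reduce φ C) in ψC
... | true  | _     rewrite satC-⊕ φ ψ C | φC      = *-⊕ φ ψ F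
... | false | true  rewrite satC-⊕ φ ψ C | φC | ψC = *-⊕ φ ψ F
... | false | false rewrite satC-⊕ φ ψ C | φC | ψC = cong₂ _∷_ (reduce-⊕ φ ψ C) (*-⊕ φ ψ F)

satC-∅ : ∀ (C : Clause n) → satC ∅ C ≡ false
satC-∅ []      = refl
satC-∅ (_ ∷ C) = satC-∅ C

reduce-∅ : ∀ (C : Clause n) → reduce ∅ C ≡ C
reduce-∅ []      = refl
reduce-∅ (c ∷ C) = cong (c ∷_) (reduce-∅ C)

∅-* : (F : ClauseSet n) → ∅ * F ≡ F
∅-* []      = refl
∅-* (C ∷ F) rewrite satC-∅ C = cong₂ _∷_ (reduce-∅ C) (∅-* F)

-- Generalised unit propagation

data Propagates {n} (P : ClauseSet n → Set) : ClauseSet n → Set where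
  found  : ∀ {F} → P F → Propagates P F
  assign : ∀ {F} → ¬ P F → (x : Lit n) → P (⟨ x ↦ false ⟩ * F) →
           Propagates P (⟨ x ↦ true ⟩ * F) → Propagates P F

-- Refuted k F means r_k(F) = {⊥}: it is IsBotBy (R k) F without the run of r_k as a witness.
Refuted : ℕ → ClauseSet n → Set
Refuted zero    F = ⊥C ∈ F
Refuted (suc k) = Propagates (Refuted k)

≈-refl : (F : ClauseSet n) → F ≈ F
≈-refl F C = mk⇔ (λ C∈ → C∈) (λ C∈ → C∈)

≈Bot⇒⊥C∈ : {F : ClauseSet n} → F ≈ Bot → ⊥C ∈ F
≈Bot⇒⊥C∈ F≈Bot = Equivalence.from (F≈Bot ⊥C) (here refl)

⊥C∈⇒Refuted : ∀ k {F : ClauseSet n} → ⊥C ∈ F → Refuted k F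
⊥C∈⇒Refuted zero    ⊥∈ = ⊥∈
⊥C∈⇒Refuted (suc k) ⊥∈ = found (⊥C∈⇒Refuted k ⊥∈)

IsBotBy⇒Refuted : ∀ k {F : ClauseSet n} → IsBotBy (R k) F → Refuted k F
Refuted⇒IsBotBy : ∀ k {F : ClauseSet n} → Refuted k F → IsBotBy (R k) F

IsBotBy⇒Refuted zero (_ , inj₁ (⊥∈ , _) , _)        = ⊥∈
IsBotBy⇒Refuted zero (_ , inj₂ (_ , refl) , F≈Bot) = ≈Bot⇒⊥C∈ F≈Bot
IsBotBy⇒Refuted {n} (suc k) (_ , step , G≈Bot) = fromStep step G≈Bot
  where
  fromStep : ∀ {F G : ClauseSet n} → Step (R k) F G → G ≈ Bot → Propagates (Refuted k) F
  fromStep (bot r)           _     = found (IsBotBy⇒Refuted k r)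
  fromStep (prop ¬r x r₀ r₁) G≈Bot =
    assign (¬r ∘ Refuted⇒IsBotBy k) x (IsBotBy⇒Refuted k r₀) (fromStep r₁ G≈Bot)
  fromStep (stay ¬r _)       F≈Bot = ⊥-elim (¬r (Refuted⇒IsBotBy k (⊥C∈⇒Refuted k (≈Bot⇒⊥C∈ F≈Bot))))

Refuted⇒IsBotBy zero    ⊥∈ = Bot , inj₁ (⊥∈ , refl) , ≈-refl Bot
Refuted⇒IsBotBy (suc k) (found r) = Bot , bot (Refuted⇒IsBotBy k r) , ≈-refl Bot
Refuted⇒IsBotBy (suc k) (assign ¬r x r₀ r₁) =
  let G , step , G≈Bot = Refuted⇒IsBotBy (suc k) r₁
  in G , prop (¬r ∘ IsBotBy⇒Refuted k) x (Refuted⇒IsBotBy k r₀) step , G≈Bot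

satC-⊥C : ∀ (φ : PAss n) → satC φ ⊥C ≡ false
satC-⊥C []      = refl
satC-⊥C (a ∷ φ) rewrite agree-nothingʳ a = satC-⊥C φ

Refuted⇒unsat : ∀ k {F : ClauseSet n} → Refuted k F → Unsatisfiable F
Refuted⇒unsat zero    ⊥∈ (t , t⊨) = Boolₚ.not-¬ (t⊨ ⊥C ⊥∈) (satC-⊥C (total t))
Refuted⇒unsat (suc k) (found r) = Refuted⇒unsat k r
Refuted⇒unsat (suc k) {F} (assign _ (v , b) r₀ r₁) =
  unsat-split F v b (Refuted⇒unsat k r₀) (Refuted⇒unsat (suc k) r₁)

literals : Clause n → ℕ
literals []            = 0
literals (just _ ∷ C)  = suc (literals C)
literals (nothing ∷ C) = literals C

size : ClauseSet n → ℕ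
size []      = 0
size (C ∷ F) = literals C + size F

literals-reduce-≤ : ∀ (φ : PAss n) C → literals (reduce φ C) ≤ literals C
literals-reduce-≤ []            []            = z≤n
literals-reduce-≤ (just _ ∷ φ)  (just _ ∷ C)  = ℕₚ.m≤n⇒m≤1+n (literals-reduce-≤ φ C)
literals-reduce-≤ (just _ ∷ φ)  (nothing ∷ C) = literals-reduce-≤ φ C
literals-reduce-≤ (nothing ∷ φ) (just _ ∷ C)  = s≤s (literals-reduce-≤ φ C)
literals-reduce-≤ (nothing ∷ φ) (nothing ∷ C) = literals-reduce-≤ φ C

literals-reduce-< : ∀ (φ : PAss n) C v {d c} → lookup φ v ≡ just d → lookup C v ≡ just c →
                    literals (reduce φ C) < literals C
literals-reduce-< (just _ ∷ φ)  (just _ ∷ C)  zero    _  _  = s≤s (literals-reduce-≤ φ C)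
literals-reduce-< (nothing ∷ φ) (_ ∷ C)       zero    () _
literals-reduce-< (just _ ∷ φ)  (nothing ∷ C) zero    _  ()
literals-reduce-< (just _ ∷ φ)  (just _ ∷ C)  (suc v) φv Cv = ℕₚ.m<n⇒m<1+n (literals-reduce-< φ C v φv Cv)
literals-reduce-< (just _ ∷ φ)  (nothing ∷ C) (suc v) φv Cv = literals-reduce-< φ C v φv Cv
literals-reduce-< (nothing ∷ φ) (just _ ∷ C)  (suc v) φv Cv = s≤s (literals-reduce-< φ C v φv Cv)
literals-reduce-< (nothing ∷ φ) (nothing ∷ C) (suc v) φv Cv = literals-reduce-< φ C v φv Cv

size-*-≤ : ∀ (φ : PAss n) F → size (φ * F) ≤ size F
size-*-≤ φ []      = z≤n
size-*-≤ φ (C ∷ F) with satC φ C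
... | true  = ℕₚ.≤-trans (size-*-≤ φ F) (ℕₚ.m≤n+m (size F) (literals C))
... | false = ℕₚ.+-mono-≤ (literals-reduce-≤ φ C) (size-*-≤ φ F)

literals-nonempty : ∀ (C : Clause n) v {c} → lookup C v ≡ just c → 1 ≤ literals C
literals-nonempty (just _ ∷ C)  zero    _  = s≤s z≤n
literals-nonempty (just _ ∷ C)  (suc v) _  = s≤s z≤n
literals-nonempty (nothing ∷ C) (suc v) Cv = literals-nonempty C v Cv

size-*-< : ∀ (φ : PAss n) F v {d} → lookup φ v ≡ just d → v occursIn F → size (φ * F) < size F
size-*-< φ (C ∷ F) v φv (_ , here refl , c , Cv) with satC φ C
... | true  = ℕₚ.≤-trans (s≤s (size-*-≤ φ F)) (ℕₚ.+-monoˡ-≤ (size F) (literals-nonempty C v Cv))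
... | false = ℕₚ.+-mono-<-≤ (literals-reduce-< φ C v φv Cv) (size-*-≤ φ F)
size-*-< φ (C ∷ F) v φv (D , there D∈ , occ) with satC φ C
... | true  = ℕₚ.<-≤-trans (size-*-< φ F v φv (D , D∈ , occ)) (ℕₚ.m≤n+m (size F) (literals C))
... | false = ℕₚ.+-mono-≤-< (literals-reduce-≤ φ C) (size-*-< φ F v φv (D , D∈ , occ))

∃-Lit? : {P : Lit n → Set} → (∀ x → Dec (P x)) → Dec (∃ P)
∃-Lit? P? = map′ (λ { (v , inj₁ p) → (v , true) , p ; (v , inj₂ p) → (v , false) , p })
                 (λ { ((v , true) , p) → v , inj₁ p ; ((v , false) , p) → v , inj₂ p })
                 (Finₚ.any? λ v → P? (v , true) ⊎-dec P? (v , false))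

Refuted? : ∀ k (F : ClauseSet n) → Dec (Refuted k F)
Refuted? zero    F = Any.any? (Vecₚ.≡-dec (Maybeₚ.≡-dec Boolₚ._≟_) ⊥C) F
Refuted? {n} (suc k) F = propagates? F (<-wellFounded (size F))
  where
  propagates? : ∀ F → Acc _<_ (size F) → Dec (Propagates (Refuted k) F)
  propagates? F (acc smaller) with Refuted? k F
  ... | yes r = yes (found r)
  ... | no ¬r = map′ (λ (x , r₀ , r₁) → assign ¬r x r₀ r₁) from (∃-Lit? step?)
    where
    from : Propagates (Refuted k) F →
           ∃ λ x → Refuted k (⟨ x ↦ false ⟩ * F) × Propagates (Refuted k) (⟨ x ↦ true ⟩ * F)
    from (found r)          = ⊥-elim (¬r r)
    from (assign _ x r₀ r₁) = x , r₀ , r₁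
    -- if v does not occur in F then ⟨ (v , b) ↦ false ⟩ * F = F, which is not refuted;
    -- so v occurs and the recursive call is on a smaller clause-set
    step? : ∀ x → Dec (Refuted k (⟨ x ↦ false ⟩ * F) × Propagates (Refuted k) (⟨ x ↦ true ⟩ * F))
    step? (v , b) with Refuted? k (single v (not b) * F) | occursIn? v F
    ... | no ¬r₀ | _      = no (¬r₀ ∘ proj₁)
    ... | yes r₀ | no v∉  = ⊥-elim (¬r (subst (Refuted k) (single-*-nonoccurring (not b) F v∉) r₀))
    ... | yes r₀ | yes v∈ =
      map′ (r₀ ,_) proj₂ (propagates? (single v b * F) (smaller (size-*-< (single v b) F v (lookup-single v b) v∈)))

Refuted-mono : ∀ k {F G : ClauseSet n} → F ⊆ G → Refuted k F → Refuted k G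
Refuted-mono zero    F⊆G ⊥∈       = F⊆G ⊥∈
Refuted-mono (suc k) F⊆G (found r) = found (Refuted-mono k F⊆G r)
Refuted-mono (suc k) {G = G} F⊆G (assign _ x r₀ r₁) with Refuted? k G
... | yes r  = found r
... | no  ¬r = assign ¬r x (Refuted-mono k (*-mono ⟨ x ↦ false ⟩ F⊆G) r₀)
                           (Refuted-mono (suc k) (*-mono ⟨ x ↦ true ⟩ F⊆G) r₁)

¬IsBotBy-⊆ : ∀ k {F G : ClauseSet n} → F ⊆ G → ¬ IsBotBy (R k) G → ¬ IsBotBy (R k) F
¬IsBotBy-⊆ k F⊆G ¬G = ¬G ∘ Refuted⇒IsBotBy k ∘ Refuted-mono k F⊆G ∘ IsBotBy⇒Refuted k

-- r_∞ and the classes PC_k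

PC-* : ∀ {k} (φ : PAss n) F → PC k F → PC k (φ * F)
PC-* {k = k} φ F pc ψ G r =
  subst (λ H → Rinf H G) (sym (*-⊕ φ ψ F)) (pc (φ ⊕ ψ) G (subst (λ H → R k H G) (*-⊕ φ ψ F) r))

PC⇒Rinf : ∀ {k} (F : ClauseSet n) → PC k F → ∀ G → R k F G → Rinf F G
PC⇒Rinf {k = k} F pc G r = subst (λ H → Rinf H G) (∅-* F) (pc ∅ G (subst (λ H → R k H G) (sym (∅-* F)) r))

forced-unique : ∀ {F : ClauseSet n} {v b c} → ModelWith F v b → Forced (v , c) F → b ≡ c
forced-unique {F = F} {v} {b} {c} model forced with b Boolₚ.≟ c
... | yes b≡c = b≡c
... | no  b≢c = ⊥-elim (Equivalence.to (forced⇔ F v c) forced (subst (ModelWith F v) (Boolₚ.¬-not b≢c) model))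

forced-single⇔ : ∀ (F : ClauseSet n) {v u} b c → Forced (v , b) F → v ≢ u →
                 Forced (u , c) (single v b * F) ⇔ Forced (u , c) F
forced-single⇔ F {v} {u} b c vb-forced v≢u = mk⇔
  (λ uc-forced → Equivalence.from (forced⇔ F u c) λ (t , t⊨ , tu) →
     no-countermodel t t⊨ tu (lookup t v Boolₚ.≟ b) uc-forced)
  (λ uc-forced → Equivalence.from (forced⇔ (single v b * F) u c) λ model →
     let t , t⊨ , _ , tu = Equivalence.to (ModelWith-single⇔ F b (not c) v≢u) model
     in Equivalence.to (forced⇔ F u c) uc-forced (t , t⊨ , tu))
  where
  no-countermodel : ∀ t → Models t F → lookup t u ≡ not c → Dec (lookup t v ≡ b) →
              Forced (u , c) (single v b * F) → ⊥
  no-countermodel t t⊨ tu (yes tv) uc-forced =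
    Equivalence.to (forced⇔ _ u c) uc-forced (Equivalence.from (ModelWith-single⇔ F b (not c) v≢u) (t , t⊨ , tv , tu))
  no-countermodel t t⊨ tu (no tv)  _ = Equivalence.to (forced⇔ F v b) vb-forced (t , t⊨ , Boolₚ.¬-not tv)

IsForcedAss-single-⊕ : ∀ (F : ClauseSet n) {v b ψ} → Forced (v , b) F → ModelWith F v b →
                       IsForcedAss (single v b * F) ψ → IsForcedAss F (single v b ⊕ ψ)
IsForcedAss-single-⊕ F {v} {b} {ψ} forced model ψ-forced u c with v Fin.≟ u
... | yes refl = subst (λ a → (a ≡ just c) ⇔ Forced (v , c) F)
                       (sym (trans (lookup-⊕ (single v b) ψ v) (cong (_<∣> _) (lookup-single v b))))
                       (mk⇔ (λ { refl → forced }) (cong just ∘ forced-unique model))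
... | no  v≢u  = subst (λ a → (a ≡ just c) ⇔ Forced (u , c) F)
                       (sym (trans (lookup-⊕ (single v b) ψ u) (cong (_<∣> _) (lookup-single-other b v≢u))))
                       (⇔-trans (ψ-forced u c) (forced-single⇔ F b c forced v≢u))

Rinf-forced : ∀ (F : ClauseSet n) {x G} → Forced x F → Rinf (⟨ x ↦ true ⟩ * F) G → Rinf F G
Rinf-forced F {v , b} forced (inj₁ (unsat , G≈Bot)) = inj₁ (unsat-split F v b forced unsat , G≈Bot)
Rinf-forced F {v , b} {G} forced (inj₂ (sat , ψ , ψ-forced , G≈)) =
  let model@(t , t⊨ , _) = Equivalence.to (satisfiable-single⇔ F v b) sat
  in inj₂ ( (t , t⊨) , single v b ⊕ ψ , IsForcedAss-single-⊕ F forced model ψ-forced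
          , subst (G ≈_) (*-⊕ (single v b) ψ F) G≈ )

Flexible : ClauseSet n → Set
Flexible F = Satisfiable F × (∀ v b → v occursIn F → ModelWith F v b)

-- A literal on an occurring variable cannot be forced: F ≈ ψ * F would lose that variable.
Rinf-self⇒Flexible : ∀ {F : ClauseSet n} → ⊥C ∉ F → Rinf F F → Flexible F
Rinf-self⇒Flexible ⊥∉ (inj₁ (_ , F≈Bot)) = ⊥-elim (⊥∉ (≈Bot⇒⊥C∈ F≈Bot))
Rinf-self⇒Flexible {F = F} ⊥∉ (inj₂ (sat , ψ , ψ-forced , F≈ψF)) = sat , free
  where
  free : ∀ v b → v occursIn F → ModelWith F v b
  free v b (C , C∈ , c , Cv) = subst (ModelWith F v) (Boolₚ.not-involutive b)
    (decidable-stable (ModelWith? F v (not (not b))) λ ¬model →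
      v-removed (∈-*⁻ ψ F (Equivalence.to (F≈ψF C) C∈))
                (Equivalence.from (ψ-forced v (not b)) (Equivalence.from (forced⇔ F v (not b)) ¬model)))
    where
    v-removed : (∃ λ C′ → C′ ∈ F × satC ψ C′ ≡ false × C ≡ reduce ψ C′) →
                lookup ψ v ≡ just (not b) → ⊥
    v-removed (C′ , _ , _ , refl) ψv with trans (sym Cv) (lookup-reduce-assigned ψ C′ v ψv)
    ... | ()

-- Acyclic families

Acyclic-reindex : ∀ {m′} {F : Fin m → ClauseSet n} {G : Fin m′ → ClauseSet n} (f : Fin m′ → Fin m) →
                  Injective _≡_ _≡_ f → (∀ i v → v occursIn G i → v occursIn F (f i)) →
                  Acyclic F → Acyclic G
Acyclic-reindex f f-inj occ acyclic c = acyclic record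
  { l = l ; vs = vs ; is = f ∘ is ; vs-inj = vs-inj ; is-inj = is-inj ∘ f-inj
  ; here = λ j → occ _ _ (Cycle.here c j) ; next = λ j → occ _ _ (next j) ; close = occ _ _ close }
  where open Cycle c hiding (here)

Acyclic-* : ∀ (φ : PAss n) (F : Fin m → ClauseSet n) → Acyclic F → Acyclic (λ i → φ * F i)
Acyclic-* φ F = Acyclic-reindex id id (λ i → occursIn-* φ (F i))

Shared : (Fin m → ClauseSet n) → Fin m → Fin n → Set
Shared F i v = v occursIn F i × ∃ λ j → j ≢ i × v occursIn F j

Leaf : (Fin m → ClauseSet n) → Fin m → Set
Leaf F i = ∀ {v w} → Shared F i v → Shared F i w → v ≡ w

Branching : (Fin m → ClauseSet n) → Fin m → Set
Branching F i = ∃₂ λ v w → v ≢ w × Shared F i v × Shared F i w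

Shared? : ∀ (F : Fin m → ClauseSet n) i v → Dec (Shared F i v)
Shared? F i v = occursIn? v (F i) ×-dec Finₚ.any? (λ j → ¬? (j Fin.≟ i) ×-dec occursIn? v (F j))

Branching? : ∀ (F : Fin m → ClauseSet n) i → Dec (Branching F i)
Branching? F i = Finₚ.any? λ v → Finₚ.any? λ w → ¬? (v Fin.≟ w) ×-dec Shared? F i v ×-dec Shared? F i w

InjectiveUpTo : {A : Set} → (ℕ → A) → ℕ → Set
InjectiveUpTo f j = ∀ {a b} → a ≤ j → b ≤ j → f a ≡ f b → a ≡ b

InjectiveUpTo-suc : ∀ {A : Set} {f : ℕ → A} {j} → InjectiveUpTo f j →
                    (∀ {a} → a ≤ j → f (suc j) ≢ f a) → InjectiveUpTo f (suc j)
InjectiveUpTo-suc {j = j} inj fresh {a} {b} a≤ b≤ fa≡fb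
  with ℕₚ.m≤n⇒m<n∨m≡n a≤ | ℕₚ.m≤n⇒m<n∨m≡n b≤
... | inj₁ a< | inj₁ b<   = inj (ℕₚ.≤-pred a<) (ℕₚ.≤-pred b<) fa≡fb
... | inj₂ refl | inj₂ refl = refl
... | inj₂ refl | inj₁ b<  = ⊥-elim (fresh (ℕₚ.≤-pred b<) fa≡fb)
... | inj₁ a<  | inj₂ refl = ⊥-elim (fresh (ℕₚ.≤-pred a<) (sym fa≡fb))

∃≤? : ∀ j {Q : ℕ → Set} → (∀ a → Dec (Q a)) → Dec (∃ λ a → a ≤ j × Q a)
∃≤? j {Q} Q? = map′ (λ (a , q) → toℕ a , ℕₚ.≤-pred (Finₚ.toℕ<n a) , q)
                    (λ (a , a≤j , q) → Fin.fromℕ< (s≤s a≤j) , subst Q (sym (Finₚ.toℕ-fromℕ< (s≤s a≤j))) q)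
                    (Finₚ.any? {n = suc j} (Q? ∘ toℕ))

-- If every member shares two distinct variables with other members, walking from a member to
-- another one through a shared variable, and leaving it through a different shared variable,
-- eventually revisits a member or a variable; the first such repetition closes a cycle.
module BranchingWalk {F : Fin (suc m) → ClauseSet n} (branching : ∀ i → Branching F i) where

  record Position : Set where
    constructor position
    field
      member : Fin (suc m)
      var    : Fin n
      shared : Shared F member var
  open Position

  record Move (s s′ : Position) : Set where
    field
      member-moves : member s′ ≢ member s
      var-moves    : var s′ ≢ var s
      var-occurs   : var s occursIn F (member s′)

  move : ∀ s → ∃ (Move s)
  move (position p w (_ , j , j≢p , w∈j)) with branching j
  ... | v₁ , v₂ , v₁≢v₂ , sh₁ , sh₂ with v₁ Fin.≟ w
  ...   | yes refl = position j v₂ sh₂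
                   , record { member-moves = j≢p ; var-moves = v₁≢v₂ ∘ sym ; var-occurs = w∈j }
  ...   | no  v₁≢w = position j v₁ sh₁
                   , record { member-moves = j≢p ; var-moves = v₁≢w ; var-occurs = w∈j }

  walk : ℕ → Position
  walk zero    = let v , _ , _ , sh , _ = branching zero in position zero v sh
  walk (suc k) = proj₁ (move (walk k))

  P : ℕ → Fin (suc m)
  P k = member (walk k)

  W : ℕ → Fin n
  W k = var (walk k)

  W-occurs : ∀ k → W k occursIn F (P k)
  W-occurs k = proj₁ (shared (walk k))

  W-occurs-next : ∀ k → W k occursIn F (P (suc k))
  W-occurs-next k = Move.var-occurs (proj₂ (move (walk k)))

  P-moves : ∀ k → P (suc k) ≢ P k
  P-moves k = Move.member-moves (proj₂ (move (walk k)))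

  W-moves : ∀ k → W (suc k) ≢ W k
  W-moves k = Move.var-moves (proj₂ (move (walk k)))

  Simple : ℕ → Set
  Simple j = InjectiveUpTo P j × InjectiveUpTo W j

  -- the cycle W i, P (i+1), W (i+1), …, W j, P (j+1), closed by W i ∈ P (j+1), where j = i + suc l
  segment-cycle : ∀ i l → Simple (i + suc l) →
                  (∀ {a} → i < a → a ≤ i + suc l → P (suc (i + suc l)) ≢ P a) →
                  W i occursIn F (P (suc (i + suc l))) → Cycle F
  segment-cycle i l (P-inj , W-inj) P-last-fresh closing = record
    { l = l ; vs = vs ; is = is ; vs-inj = vs-inj ; is-inj = is-inj
    ; here = λ t → subst (λ a → vs t occursIn F (P a)) (sym (ℕₚ.+-suc i (toℕ t))) (W-occurs-next (i + toℕ t))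
    ; next = λ t → subst (λ a → vs (suc t) occursIn F (P (i + suc a))) (sym (Finₚ.toℕ-inject₁ t))
                         (W-occurs (i + suc (toℕ t)))
    ; close = subst₂ (λ a b → W a occursIn F (P b)) (sym (ℕₚ.+-identityʳ i)) last-index closing }
    where
    j : ℕ
    j = i + suc l
    vs : Fin (suc (suc l)) → Fin n
    vs t = W (i + toℕ t)
    is : Fin (suc (suc l)) → Fin (suc m)
    is t = P (i + suc (toℕ t))
    last-index : suc j ≡ i + suc (toℕ (fromℕ (suc l)))
    last-index = trans (sym (ℕₚ.+-suc i (suc l))) (cong (λ a → i + suc a) (sym (Finₚ.toℕ-fromℕ (suc l))))
    in-segment : ∀ {a} → a ≤ l → i + suc a ≤ j
    in-segment a≤l = ℕₚ.+-monoʳ-≤ i (s≤s a≤l)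
    toℕ≤ : ∀ (t : Fin (suc (suc l))) → toℕ t ≤ suc l
    toℕ≤ t = ℕₚ.≤-pred (Finₚ.toℕ<n t)
    vs-inj : Injective _≡_ _≡_ vs
    vs-inj {t} {t′} eq = Finₚ.toℕ-injective
      (ℕₚ.+-cancelˡ-≡ i _ _ (W-inj (ℕₚ.+-monoʳ-≤ i (toℕ≤ t)) (ℕₚ.+-monoʳ-≤ i (toℕ≤ t′)) eq))
    is-injℕ : ∀ {a b} → a ≤ suc l → b ≤ suc l → P (i + suc a) ≡ P (i + suc b) → a ≡ b
    is-injℕ {a} {b} a≤ b≤ eq with ℕₚ.m≤n⇒m<n∨m≡n a≤ | ℕₚ.m≤n⇒m<n∨m≡n b≤
    ... | inj₁ a< | inj₁ b<    = ℕₚ.suc-injective (ℕₚ.+-cancelˡ-≡ i _ _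
                                   (P-inj (in-segment (ℕₚ.≤-pred a<)) (in-segment (ℕₚ.≤-pred b<)) eq))
    ... | inj₂ refl | inj₂ refl = refl
    ... | inj₂ refl | inj₁ b<  = ⊥-elim (P-last-fresh (ℕₚ.m<m+n i (s≤s z≤n)) (in-segment (ℕₚ.≤-pred b<))
                                   (trans (cong P (sym (ℕₚ.+-suc i (suc l)))) eq))
    ... | inj₁ a<  | inj₂ refl = ⊥-elim (P-last-fresh (ℕₚ.m<m+n i (s≤s z≤n)) (in-segment (ℕₚ.≤-pred a<))
                                   (trans (cong P (sym (ℕₚ.+-suc i (suc l)))) (sym eq)))
    is-inj : Injective _≡_ _≡_ is
    is-inj {t} {t′} eq = Finₚ.toℕ-injective (is-injℕ (toℕ≤ t) (toℕ≤ t′) eq)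

  P-repeat-cycle : ∀ {i j} → i ≤ j → Simple j → P (suc j) ≡ P i → Cycle F
  P-repeat-cycle {i} i≤j simple P-repeat with ℕₚ.m≤n⇒∃[o]m+o≡n i≤j
  ... | zero  , refl = ⊥-elim (P-moves i (trans (cong (P ∘ suc) (sym (ℕₚ.+-identityʳ i))) P-repeat))
  ... | suc l , refl = segment-cycle i l simple P-last-fresh (subst (W i occursIn_) (cong F (sym P-repeat)) (W-occurs i))
    where
    P-last-fresh : ∀ {a} → i < a → a ≤ i + suc l → P (suc (i + suc l)) ≢ P a
    P-last-fresh i<a a≤ eq = ℕₚ.<⇒≢ i<a (proj₁ simple i≤j a≤ (trans (sym P-repeat) eq))

  W-repeat-cycle : ∀ {i j} → i ≤ j → Simple j → (∀ {a} → a ≤ j → P (suc j) ≢ P a) →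
                   W (suc j) ≡ W i → Cycle F
  W-repeat-cycle {i} {j} i≤j simple P-fresh W-repeat with ℕₚ.m≤n⇒∃[o]m+o≡n i≤j
  ... | zero  , refl = ⊥-elim (W-moves i (trans (cong (W ∘ suc) (sym (ℕₚ.+-identityʳ i))) W-repeat))
  ... | suc l , refl = segment-cycle i l simple (λ _ → P-fresh) (subst (_occursIn F (P (suc j))) W-repeat (W-occurs (suc j)))

  grow : ∀ j → Simple j → Cycle F ⊎ Simple (suc j)
  grow j simple with ∃≤? j (λ a → P (suc j) Fin.≟ P a)
  ... | yes (i , i≤j , P-repeat) = inj₁ (P-repeat-cycle i≤j simple P-repeat)
  ... | no  P-fresh with ∃≤? j (λ a → W (suc j) Fin.≟ W a)
  ...   | yes (i , i≤j , W-repeat) = inj₁ (W-repeat-cycle i≤j simple (λ a≤ eq → P-fresh (_ , a≤ , eq)) W-repeat)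
  ...   | no  W-fresh = inj₂ ( InjectiveUpTo-suc (proj₁ simple) (λ a≤ eq → P-fresh (_ , a≤ , eq))
                             , InjectiveUpTo-suc (proj₂ simple) (λ a≤ eq → W-fresh (_ , a≤ , eq)) )

  run : ∀ j → Cycle F ⊎ Simple j
  run zero    = inj₂ ((λ { z≤n z≤n _ → refl }) , (λ { z≤n z≤n _ → refl }))
  run (suc j) with run j
  ... | inj₁ c      = inj₁ c
  ... | inj₂ simple = grow j simple

  -- a simple walk cannot visit m + 2 members of a family of size m + 1
  cycle : Cycle F
  cycle with run (suc m)
  ... | inj₁ c          = c
  ... | inj₂ (P-inj , _) with Finₚ.pigeonhole (ℕₚ.n<1+n (suc m)) (P ∘ toℕ)
  ...   | a , b , a<b , eq =
    ⊥-elim (ℕₚ.<⇒≢ a<b (P-inj (ℕₚ.≤-pred (Finₚ.toℕ<n a)) (ℕₚ.≤-pred (Finₚ.toℕ<n b)) eq))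

leaf-exists : (F : Fin (suc m) → ClauseSet n) → Acyclic F → ∃ (Leaf F)
leaf-exists F acyclic with Finₚ.any? (¬? ∘ Branching? F)
... | yes (i , ¬branching) = i , λ {v} {w} sh-v sh-w →
  decidable-stable (v Fin.≟ w) λ v≢w → ¬branching (v , w , v≢w , sh-v , sh-w)
... | no  all-branching = ⊥-elim (acyclic (BranchingWalk.cycle λ i →
  decidable-stable (Branching? F i) λ ¬branching → all-branching (i , ¬branching)))

-- Gluing models along a leaf

JointModel : (Fin m → ClauseSet n) → Vec Bool n → Set
JointModel F t = ∀ i → Models t (F i)

JointlyFree : (Fin m → ClauseSet n) → Set
JointlyFree F = ∃ (JointModel F) × (∀ v b → ∃ λ t → JointModel F t × lookup t v ≡ b)

AgreeOnShared : (Fin m → ClauseSet n) → Fin m → Vec Bool n → Vec Bool n → Set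
AgreeOnShared F i t t′ = ∀ {s} → Shared F i s → lookup t s ≡ lookup t′ s

agreeing : ∀ (F : Fin m → ClauseSet n) {i} → Leaf F i → {P : Vec Bool n → Set} → ∃ P →
           (∀ {s} b → Shared F i s → ∃ λ t → P t × lookup t s ≡ b) →
           ∀ t₀ → ∃ λ t → P t × AgreeOnShared F i t₀ t
agreeing F {i} leaf nonempty free t₀ with Finₚ.any? (Shared? F i)
... | yes (s₀ , sh₀) = let t , Pt , ts₀ = free (lookup t₀ s₀) sh₀ in
                       t , Pt , λ sh → subst (λ s → lookup t₀ s ≡ lookup t s) (sym (leaf sh sh₀)) (sym ts₀)
... | no  none       = let t , Pt = nonempty in t , Pt , λ {s} sh → ⊥-elim (none (s , sh))

glue : ClauseSet n → Vec Bool n → Vec Bool n → Vec Bool n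
glue B t t′ = tabulate λ u → if does (occursIn? u B) then lookup t′ u else lookup t u

lookup-glue-∈ : ∀ {B : ClauseSet n} {u} t t′ → u occursIn B → lookup (glue B t t′) u ≡ lookup t′ u
lookup-glue-∈ {B = B} {u} t t′ u∈ = trans (Vecₚ.lookup∘tabulate _ u) (choose (occursIn? u B))
  where
  choose : ∀ d → (if does d then lookup t′ u else lookup t u) ≡ lookup t′ u
  choose (yes _) = refl
  choose (no u∉) = ⊥-elim (u∉ u∈)

lookup-glue-∉ : ∀ {B : ClauseSet n} {u} t t′ → ¬ u occursIn B → lookup (glue B t t′) u ≡ lookup t u
lookup-glue-∉ {B = B} {u} t t′ u∉ = trans (Vecₚ.lookup∘tabulate _ u) (choose (occursIn? u B))
  where
  choose : ∀ d → (if does d then lookup t′ u else lookup t u) ≡ lookup t u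
  choose (yes u∈) = ⊥-elim (u∉ u∈)
  choose (no _)   = refl

glue-JointModel : ∀ (F : Fin (suc m) → ClauseSet n) i t t′ → JointModel (F ∘ punchIn i) t →
                  Models t′ (F i) → AgreeOnShared F i t t′ → JointModel F (glue (F i) t t′)
glue-JointModel F i t t′ t⊨ t′⊨ agree j with i Fin.≟ j
... | yes refl = Models-cong t′ (glue (F i) t t′) (F i) t′⊨ λ u u∈ → sym (lookup-glue-∈ t t′ u∈)
... | no  i≢j  = Models-cong t (glue (F i) t t′) (F j)
                   (subst (Models t ∘ F) (Finₚ.punchIn-punchOut i≢j) (t⊨ (punchOut i≢j))) same
  where
  same : ∀ u → u occursIn F j → lookup t u ≡ lookup (glue (F i) t t′) u
  same u u∈j with occursIn? u (F i)
  ... | yes u∈i = trans (agree (u∈i , j , i≢j ∘ sym , u∈j)) (sym (lookup-glue-∈ t t′ u∈i))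
  ... | no  u∉i = sym (lookup-glue-∉ t t′ u∉i)

Flexible⇒JointlyFree : ∀ (F : Fin m → ClauseSet n) → Acyclic F → (∀ i → Flexible (F i)) → JointlyFree F
Flexible⇒JointlyFree {zero} {n} F _ _ =
  (replicate n true , λ ()) , λ v b → replicate n true [ v ]≔ b , (λ ()) , Vecₚ.lookup∘update v (replicate n true) b
Flexible⇒JointlyFree {suc m} {n} F acyclic flexible = joint-model , joint-model-with
  where
  i : Fin (suc m)
  i = proj₁ (leaf-exists F acyclic)

  leaf : Leaf F i
  leaf = proj₂ (leaf-exists F acyclic)

  rest : Fin m → ClauseSet n
  rest = F ∘ punchIn i

  rest-free : JointlyFree rest
  rest-free = Flexible⇒JointlyFree rest
    (Acyclic-reindex (punchIn i) (Finₚ.punchIn-injective i _ _) (λ _ _ occ → occ) acyclic) (flexible ∘ punchIn i)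

  leaf-matching : ∀ t → ∃ λ t′ → Models t′ (F i) × AgreeOnShared F i t t′
  leaf-matching = agreeing F leaf (proj₁ (flexible i)) λ b sh → proj₂ (flexible i) _ b (proj₁ sh)

  rest-matching : ∀ t′ → ∃ λ t → JointModel rest t × AgreeOnShared F i t′ t
  rest-matching = agreeing F leaf (proj₁ rest-free) λ b _ → proj₂ rest-free _ b

  joint-model : ∃ (JointModel F)
  joint-model = let t , t⊨ = proj₁ rest-free ; t′ , t′⊨ , agree = leaf-matching t
                in glue (F i) t t′ , glue-JointModel F i t t′ t⊨ t′⊨ agree

  joint-model-with : ∀ v b → ∃ λ t → JointModel F t × lookup t v ≡ b
  joint-model-with v b with occursIn? v (F i)
  ... | yes v∈ = let t′ , t′⊨ , t′v = proj₂ (flexible i) v b v∈ ; t , t⊨ , agree = rest-matching t′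
                 in glue (F i) t t′ , glue-JointModel F i t t′ t⊨ t′⊨ (sym ∘ agree)
                  , trans (lookup-glue-∈ t t′ v∈) t′v
  ... | no  v∉ = let t , t⊨ , tv = proj₂ rest-free v b ; t′ , t′⊨ , agree = leaf-matching t
                 in glue (F i) t t′ , glue-JointModel F i t t′ t⊨ t′⊨ agree
                  , trans (lookup-glue-∉ t t′ v∉) tv

IsUnion : ClauseSet n → (Fin m → ClauseSet n) → Set
IsUnion U F = (∀ {C} → C ∈ U → ∃ λ i → C ∈ F i) × (∀ i → F i ⊆ U)

⋃-IsUnion : (F : Fin m → ClauseSet n) → IsUnion (⋃ F) F
⋃-IsUnion {m} F = (λ C∈ → let i , _ , C∈i = find (∈-concatMap⁻ F {xs = allFin m} C∈) in i , C∈i)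
                , (λ i C∈i → ∈-concatMap⁺ F {xs = allFin m} (lose (∈-allFin i) C∈i))

IsUnion-* : ∀ (φ : PAss n) {U} {F : Fin m → ClauseSet n} → IsUnion U F → IsUnion (φ * U) (λ i → φ * F i)
IsUnion-* φ {U} {F} (⊆⋃ , ⋃⊆) = covered , (λ i → *-mono φ (⋃⊆ i))
  where
  covered : ∀ {C} → C ∈ φ * U → ∃ λ i → C ∈ φ * F i
  covered C∈ with ∈-*⁻ φ U C∈
  ... | C′ , C′∈ , unsat , refl = let i , C′∈i = ⊆⋃ C′∈ in i , ∈-*⁺ φ (F i) C′∈i unsat

Models-union : ∀ {U : ClauseSet n} {F : Fin m → ClauseSet n} → IsUnion U F → ∀ t → JointModel F t → Models t U
Models-union (⊆⋃ , _) t t⊨ C C∈ = let i , C∈i = ⊆⋃ C∈ in t⊨ i C C∈i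

Rinf-self-union : ∀ {U : ClauseSet n} {F : Fin m → ClauseSet n} → IsUnion U F → Acyclic F →
             (∀ i → Rinf (F i) (F i)) → ⊥C ∉ U → Rinf U U
Rinf-self-union {n} {U = U} {F} union acyclic Rinf-members ⊥∉ = inj₂ (satisfiable , ∅ , nothing-forced , ≈-refl-∅)
  where
  free : JointlyFree F
  free = Flexible⇒JointlyFree F acyclic λ i → Rinf-self⇒Flexible (⊥∉ ∘ proj₂ union i) (Rinf-members i)
  satisfiable : Satisfiable U
  satisfiable = let t , t⊨ = proj₁ free in t , Models-union union t t⊨
  nothing≢just : ∀ {b : Bool} → nothing ≢ just b
  nothing≢just ()
  nothing-forced : IsForcedAss U ∅
  nothing-forced v c = mk⇔
    (λ ∅v → ⊥-elim (nothing≢just (trans (sym (Vecₚ.lookup-replicate v nothing)) ∅v)))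
    (λ forced → let t , t⊨ , tv = proj₂ free v (not c)
                in ⊥-elim (Equivalence.to (forced⇔ U v c) forced (t , Models-union union t t⊨ , tv)))
  ≈-refl-∅ : U ≈ (∅ * U)
  ≈-refl-∅ = subst (U ≈_) (sym (∅-* U)) (≈-refl U)

R⇒Rinf-union : ∀ k {U G} (F : Fin m → ClauseSet n) → IsUnion U F → Acyclic F → (∀ i → PC k (F i)) →
               R k U G → Rinf U G
R⇒Rinf-union zero    F union acyclic pc (inj₁ (⊥∈ , refl)) = inj₁ (Refuted⇒unsat zero ⊥∈ , ≈-refl Bot)
R⇒Rinf-union zero    F union acyclic pc (inj₂ (⊥∉ , refl)) =
  Rinf-self-union union acyclic (λ i → PC⇒Rinf (F i) (pc i) (F i) (inj₂ (⊥∉ ∘ proj₂ union i , refl))) ⊥∉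
R⇒Rinf-union (suc k) F union acyclic pc (bot r) = inj₁ (Refuted⇒unsat k (IsBotBy⇒Refuted k r) , ≈-refl Bot)
R⇒Rinf-union (suc k) {U} F union acyclic pc (prop _ x r₀ step) =
  Rinf-forced U (Refuted⇒unsat k (IsBotBy⇒Refuted k r₀))
    (R⇒Rinf-union (suc k) (λ i → ⟨ x ↦ true ⟩ * F i) (IsUnion-* ⟨ x ↦ true ⟩ union)
      (Acyclic-* ⟨ x ↦ true ⟩ F acyclic)
      (λ i → PC-* ⟨ x ↦ true ⟩ (F i) (pc i)) step)
R⇒Rinf-union (suc k) {U} F union acyclic pc (stay ¬r ¬r-x) =
  Rinf-self-union union acyclic stays (λ ⊥∈ → ¬r (Refuted⇒IsBotBy k (⊥C∈⇒Refuted k ⊥∈)))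
  where
  stays : ∀ i → Rinf (F i) (F i)
  stays i = PC⇒Rinf (F i) (pc i) (F i)
    (stay (¬IsBotBy-⊆ k (proj₂ union i) ¬r)
          (λ x → ¬IsBotBy-⊆ k (*-mono ⟨ x ↦ false ⟩ (proj₂ union i)) (¬r-x x)))

theorem4p6 : (n k m : ℕ) (F : Fin m → ClauseSet n) →
             Acyclic F → (∀ i → PC k (F i)) → PC k (⋃ F)
theorem4p6 n k m F acyclic pc φ G =
  R⇒Rinf-union k (λ i → φ * F i) (IsUnion-* φ (⋃-IsUnion F))
    (Acyclic-* φ F acyclic) (λ i → PC-* φ (F i) (pc i))
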